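{- Let $p,q\ge 1$ and $n\ge 2$ be integers. Let $K_{p,q}$ be the complete bipartite graph with parts $P$ ($|P|=p$) and $Q$ ($|Q|=q$), and let $K_{p, q}\circ_{1}K_n$ be the graph obtained by identifying a vertex $a\in P$ with a vertex of the complete graph $K_n$; let $N$ denote the set of the other $n-1$ vertices of $K_n$. Then the resistance distances in $K_{p, q}\circ_{1}K_n$ are: $r(a,x)=\frac{2}{q}$ for $x\in P\setminus\{a\}$; $r(a,y)=\frac{p+q-1}{pq}$ for $y\in Q$; $r(a,z)=\frac{2}{n}$ for $z\in N$; $r(x,x')=\frac{2}{q}$ for distinct $x,x'\in P\setminus\{a\}$; $r(x,y)=\frac{p+q-1}{pq}$ for $x\in P\setminus\{a\}$, $y\in Q$; $r(x,z)=\frac{2(q+n)}{qn}$ for $x\in P\setminus\{a\}$, $z\in N$; $r(y,y')=\frac{2}{p}$ for distinct $y,y'\in Q$; $r(y,z)=\frac{q(n+2p)+n(p-1)}{npq}$ for $y\in Q$, $z\in N$; $r(z,z')=\frac{2}{n}$ for distinct $z,z'\in N$.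
   Context: The resistance distance between vertices of a connected graph is the effective resistance between them when every edge is a resistor of $1\Omega$; equivalently $r_{ij}=l^{\#}_{ii}+l^{\#}_{jj}-2l^{\#}_{ij}$ with $L^{\#}$ the group inverse of the Laplacian $L=D-A$. -}

module Defs where

open import Data.Nat as ℕ using (ℕ; zero; suc; _∸_; _≡ᵇ_; _<ᵇ_)
open import Data.Bool using (Bool; true; false; if_then_else_; not)
open import Data.Fin using (Fin; toℕ; zero; suc)
open import Data.Product using (_×_)
open import Data.Integer using (ℤ; +_)
open import Data.Rational using (ℚ; 0ℚ; 1ℚ; _+_; _*_; _-_; -_; _/_)
open import Relation.Binary.PropositionalEquality using (_≡_)

-- The four kinds of vertices of K_{p,q} ∘₁ K_n:
-- vA = the identified vertex a, vP = P \ {a}, vQ = Q, vN = N.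
data Kind : Set where
  vA vP vQ vN : Kind

kind : (p q : ℕ) → ℕ → Kind
kind p q k =
  if k ≡ᵇ 0 then vA
  else if k <ᵇ p then vP
  else if k <ᵇ p ℕ.+ q then vQ
  else vN

nV : (p q n : ℕ) → ℕ
nV p q n = p ℕ.+ q ℕ.+ (n ∸ 1)

-- Adjacency of K_{p,q} ∘₁ K_n (on vertex indices):
-- edges of K_{p,q} join P = {a} ∪ (P\{a}) with Q;
-- edges of K_n join distinct vertices of {a} ∪ N.
adjK : Kind → Kind → Bool
adjK vA vQ = true
adjK vP vQ = true
adjK vQ vA = true
adjK vQ vP = true
adjK _  _  = false

inKn : Kind → Bool
inKn vA = true
inKn vN = true
inKn _  = false

adj : (p q : ℕ) → ℕ → ℕ → Bool
adj p q i j =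
  if adjK (kind p q i) (kind p q j) then true
  else if inKn (kind p q i) then (if inKn (kind p q j) then not (i ≡ᵇ j) else false)
  else false

Mat : ℕ → Set
Mat m = Fin m → Fin m → ℚ

sumFin : ∀ {m} → (Fin m → ℚ) → ℚ
sumFin {zero}  f = 0ℚ
sumFin {suc m} f = f zero + sumFin (λ i → f (suc i))

_⊗_ : ∀ {m} → Mat m → Mat m → Mat m
(A ⊗ B) i j = sumFin (λ k → A i k * B k j)

b2q : Bool → ℚ
b2q true  = 1ℚ
b2q false = 0ℚ

adjacency : (p q n : ℕ) → Mat (nV p q n)
adjacency p q n i j = b2q (adj p q (toℕ i) (toℕ j))

degree : (p q n : ℕ) → Fin (nV p q n) → ℚ
degree p q n i = sumFin (λ k → adjacency p q n i k)

laplacian : (p q n : ℕ) → Mat (nV p q n)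
laplacian p q n i j =
  (if toℕ i ≡ᵇ toℕ j then degree p q n i else 0ℚ) - adjacency p q n i j

IsGroupInverse : ∀ {m} → Mat m → Mat m → Set
IsGroupInverse L X =
  (∀ i j → ((L ⊗ X) ⊗ L) i j ≡ L i j) ×
  (∀ i j → ((X ⊗ L) ⊗ X) i j ≡ X i j) ×
  (∀ i j → (L ⊗ X) i j ≡ (X ⊗ L) i j)

2ℚ : ℚ
2ℚ = + 2 / 1

resistance : ∀ {m} → Mat m → Fin m → Fin m → ℚ
resistance X i j = X i i + X j j - 2ℚ * X i j

-- Total division num / den (den = 0 gives 0; only used with den ≥ 1).
frac : ℤ → ℕ → ℚ
frac a zero    = 0ℚ
frac a (suc d) = a / suc d

{-# OPTIONS --safe #-}
-- Let L be the Laplacian and Y the inverse of L with the row and column of a deleted, padded with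
-- zeros, so that L Y = I − eₐ 1ᵀ. For the centring matrix H = I − (1/m) 1 1ᵀ, H Y H is a group
-- inverse of L, hence the group inverse, and it has the same resistances Yᵢᵢ + Yⱼⱼ − 2 Yᵢⱼ as Y,
-- because H only adds terms of the form αᵢ + αⱼ + γ. Up to a diagonal term, Y is constant on the
-- blocks {a}, P ∖ {a}, Q, N, and L acts on block-constant vectors through the neighbour counts of
-- the blocks; so L Y = I − eₐ 1ᵀ and the resistances reduce to identities between block values
-- built from 1/p, 1/q and 1/n.
module Submission where

open import Defs

module Development where

  open import Data.Bool using (Bool; true; false; if_then_else_; not; _∧_; _∨_)
  open import Data.Bool.Properties using (∧-identityʳ; ∧-zeroʳ)
  open import Data.Empty using (⊥; ⊥-elim)
  open import Data.Fin using (Fin; toℕ; zero; suc)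
  open import Data.Fin.Properties using (toℕ-injective)
  open import Data.Integer as ℤ using (+_)
  import Data.Integer.Properties as ℤ
  open import Data.List using (_∷_; [])
  open import Data.Nat as ℕ using (ℕ; zero; suc; _≡ᵇ_; _<ᵇ_; z≤n; s≤s)
  import Data.Nat.Properties as ℕ
  open import Data.Product using (_,_)
  open import Data.Rational using (ℚ; 0ℚ; 1ℚ; _+_; _*_; _-_; _/_; toℚᵘ)
  import Data.Rational.Properties as ℚ
  import Data.Rational.Unnormalised.Base as ℚᵘ
  import Data.Rational.Unnormalised.Properties as ℚᵘ
  open import Data.Unit using (tt)
  open import Level using (0ℓ)
  open import Relation.Binary.Bundles using (Setoid)
  open import Relation.Binary.PropositionalEquality
  import Relation.Binary.Reasoning.Setoid as SetoidReasoning
  open import Relation.Nullary using (Dec; yes; no)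
  open import Relation.Nullary.Decidable using (dec⇒maybe)
  import Tactic.RingSolver.Core.AlmostCommutativeRing as ACR
  open import Tactic.RingSolver using (solve-∀; solve)

  ℚ-ring : ACR.AlmostCommutativeRing _ _
  ℚ-ring = ACR.fromCommutativeRing ℚ.+-*-commutativeRing (λ x → dec⇒maybe (0ℚ ℚ.≟ x))

  distrib-1+ : ∀ x y → y + x * y ≡ (1ℚ + x) * y
  distrib-1+ = solve-∀ ℚ-ring

  *-distribˡ-- : ∀ x y z → x * (y - z) ≡ x * y - x * z
  *-distribˡ-- = solve-∀ ℚ-ring

  *-distribʳ-- : ∀ x y z → (y - z) * x ≡ y * x - z * x
  *-distribʳ-- = solve-∀ ℚ-ring

  fromℕ : ℕ → ℚ
  fromℕ zero    = 0ℚ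
  fromℕ (suc k) = 1ℚ + fromℕ k

  fromℕ-+ : ∀ a b → fromℕ (a ℕ.+ b) ≡ fromℕ a + fromℕ b
  fromℕ-+ zero    b = sym (ℚ.+-identityˡ (fromℕ b))
  fromℕ-+ (suc a) b = trans (cong (λ y → 1ℚ + y) (fromℕ-+ a b)) (sym (ℚ.+-assoc 1ℚ (fromℕ a) (fromℕ b)))

  fromℕ-* : ∀ a b → fromℕ (a ℕ.* b) ≡ fromℕ a * fromℕ b
  fromℕ-* zero    b = sym (ℚ.*-zeroˡ (fromℕ b))
  fromℕ-* (suc a) b = begin
    fromℕ (b ℕ.+ a ℕ.* b)        ≡⟨ fromℕ-+ b (a ℕ.* b) ⟩
    fromℕ b + fromℕ (a ℕ.* b)    ≡⟨ cong (λ y → fromℕ b + y) (fromℕ-* a b) ⟩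
    fromℕ b + fromℕ a * fromℕ b  ≡⟨ distrib-1+ (fromℕ a) (fromℕ b) ⟩
    (1ℚ + fromℕ a) * fromℕ b     ∎
    where open ≡-Reasoning

  toℚᵘ-/ : ∀ a d → toℚᵘ (+ a / suc d) ℚᵘ.≃ ℚᵘ.mkℚᵘ (+ a) d
  toℚᵘ-/ a d = ℚ.toℚᵘ-fromℚᵘ (ℚᵘ.mkℚᵘ (+ a) d)

  fromℕ-/1 : ∀ k → fromℕ k ≡ + k / 1
  fromℕ-/1 zero    = refl
  fromℕ-/1 (suc k) = trans (cong (λ y → 1ℚ + y) (fromℕ-/1 k)) (ℚ.toℚᵘ-injective add)
    where
    numerators : (+ 1 ℤ.* + 1 ℤ.+ + k ℤ.* + 1) ℤ.* + 1 ≡ + suc k ℤ.* + 1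
    numerators = trans (ℤ.*-identityʳ _) (trans (cong (λ y → + 1 ℤ.+ y) (ℤ.*-identityʳ (+ k))) (sym (ℤ.*-identityʳ (+ suc k))))
    add : toℚᵘ (1ℚ + + k / 1) ℚᵘ.≃ toℚᵘ (+ suc k / 1)
    add = ℚᵘ.≃-trans (ℚ.toℚᵘ-homo-+ 1ℚ (+ k / 1))
      (ℚᵘ.≃-trans (ℚᵘ.+-cong (toℚᵘ-/ 1 0) (toℚᵘ-/ k 0))
      (ℚᵘ.≃-trans (ℚᵘ.*≡* numerators) (ℚᵘ.≃-sym (toℚᵘ-/ (suc k) 0))))

  /-*-fromℕ : ∀ a d → (+ a / suc d) * fromℕ (suc d) ≡ fromℕ a
  /-*-fromℕ a d = begin
    (+ a / suc d) * fromℕ (suc d)   ≡⟨ cong ((+ a / suc d) *_) (fromℕ-/1 (suc d)) ⟩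
    (+ a / suc d) * (+ suc d / 1)   ≡⟨ ℚ.toℚᵘ-injective cancel ⟩
    + a / 1                         ≡⟨ sym (fromℕ-/1 a) ⟩
    fromℕ a                         ∎
    where
    open ≡-Reasoning
    numerators : (+ a ℤ.* + suc d) ℤ.* + 1 ≡ + a ℤ.* + suc (d ℕ.* 1)
    numerators = trans (ℤ.*-identityʳ _) (cong (λ x → + a ℤ.* + suc x) (sym (ℕ.*-identityʳ d)))
    cancel : toℚᵘ ((+ a / suc d) * (+ suc d / 1)) ℚᵘ.≃ toℚᵘ (+ a / 1)
    cancel = ℚᵘ.≃-trans (ℚ.toℚᵘ-homo-* (+ a / suc d) (+ suc d / 1))
      (ℚᵘ.≃-trans (ℚᵘ.*-cong (toℚᵘ-/ a d) (toℚᵘ-/ (suc d) 0))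
      (ℚᵘ.≃-trans (ℚᵘ.*≡* numerators) (ℚᵘ.≃-sym (toℚᵘ-/ a 0))))

  fromℕ-*-inverse : ∀ d → fromℕ (suc d) * (+ 1 / suc d) ≡ 1ℚ
  fromℕ-*-inverse d = trans (ℚ.*-comm (fromℕ (suc d)) (+ 1 / suc d)) (/-*-fromℕ 1 d)

  frac-unique : ∀ k D {x D′ K′} .{{_ : ℕ.NonZero D}} → fromℕ D ≡ D′ → fromℕ k ≡ K′ → D′ * x ≡ K′ → frac (+ k) D ≡ x
  frac-unique k (suc d) {x} refl refl D*x≡K = begin
    + k / suc d                              ≡⟨ ℚ.*-identityʳ _ ⟨
    + k / suc d * 1ℚ                         ≡⟨ cong (λ y → + k / suc d * y) (/-*-fromℕ 1 d) ⟨
    + k / suc d * ((+ 1 / suc d) * D)        ≡⟨ rearrange (+ k / suc d) (+ 1 / suc d) D ⟩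
    (+ 1 / suc d) * ((+ k / suc d) * D)      ≡⟨ cong (λ y → (+ 1 / suc d) * y) (trans (/-*-fromℕ k d) (sym D*x≡K)) ⟩
    (+ 1 / suc d) * (D * x)                  ≡⟨ ℚ.*-assoc (+ 1 / suc d) D x ⟨
    ((+ 1 / suc d) * D) * x                  ≡⟨ cong (_* x) (/-*-fromℕ 1 d) ⟩
    1ℚ * x                                   ≡⟨ ℚ.*-identityˡ x ⟩
    x                                        ∎
    where
    open ≡-Reasoning
    D = fromℕ (suc d)
    rearrange : ∀ f i D → f * (i * D) ≡ i * (f * D)
    rearrange = solve-∀ ℚ-ring

  δ : ∀ {m} → Fin m → Fin m → ℚ
  δ i j = b2q (toℕ i ≡ᵇ toℕ j)

  module _ where
    open ≡-Reasoning

    sumFin-cong : ∀ {m} {f g : Fin m → ℚ} → (∀ k → f k ≡ g k) → sumFin f ≡ sumFin g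
    sumFin-cong {zero}  f≡g = refl
    sumFin-cong {suc m} f≡g = cong₂ _+_ (f≡g zero) (sumFin-cong (λ k → f≡g (suc k)))

    sumFin-zero : ∀ {m} {f : Fin m → ℚ} → (∀ k → f k ≡ 0ℚ) → sumFin f ≡ 0ℚ
    sumFin-zero {zero}  f≡0 = refl
    sumFin-zero {suc m} f≡0 = cong₂ _+_ (f≡0 zero) (sumFin-zero (λ k → f≡0 (suc k)))

    sumFin-+ : ∀ {m} (f g : Fin m → ℚ) → sumFin (λ k → f k + g k) ≡ sumFin f + sumFin g
    sumFin-+ {zero}  f g = refl
    sumFin-+ {suc m} f g = trans (cong (λ s → f zero + g zero + s) (sumFin-+ (λ k → f (suc k)) (λ k → g (suc k))))
      (interchange (f zero) (g zero) _ _)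
      where
      interchange : ∀ a b c d → (a + b) + (c + d) ≡ (a + c) + (b + d)
      interchange = solve-∀ ℚ-ring

    sumFin-- : ∀ {m} (f g : Fin m → ℚ) → sumFin (λ k → f k - g k) ≡ sumFin f - sumFin g
    sumFin-- {zero}  f g = refl
    sumFin-- {suc m} f g = trans (cong (λ s → f zero - g zero + s) (sumFin-- (λ k → f (suc k)) (λ k → g (suc k))))
      (interchange-- (f zero) (g zero) _ _)
      where
      interchange-- : ∀ a b c d → (a - b) + (c - d) ≡ (a + c) - (b + d)
      interchange-- = solve-∀ ℚ-ring

    sumFin-*ˡ : ∀ {m} (c : ℚ) (f : Fin m → ℚ) → sumFin (λ k → c * f k) ≡ c * sumFin f
    sumFin-*ˡ {zero}  c f = sym (ℚ.*-zeroʳ c)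
    sumFin-*ˡ {suc m} c f = trans (cong (λ s → c * f zero + s) (sumFin-*ˡ c (λ k → f (suc k))))
      (sym (ℚ.*-distribˡ-+ c (f zero) _))

    sumFin-*ʳ : ∀ {m} (c : ℚ) (f : Fin m → ℚ) → sumFin (λ k → f k * c) ≡ sumFin f * c
    sumFin-*ʳ {zero}  c f = sym (ℚ.*-zeroˡ c)
    sumFin-*ʳ {suc m} c f = trans (cong (λ s → f zero * c + s) (sumFin-*ʳ c (λ k → f (suc k))))
      (sym (ℚ.*-distribʳ-+ c (f zero) _))

    sumFin-comm : ∀ {m n} (f : Fin m → Fin n → ℚ) →
      sumFin (λ i → sumFin (λ j → f i j)) ≡ sumFin (λ j → sumFin (λ i → f i j))
    sumFin-comm {zero} {n} f = sym (sumFin-zero {n} (λ _ → refl))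
    sumFin-comm {suc m} f = trans (cong (λ s → sumFin (f zero) + s) (sumFin-comm (λ i → f (suc i))))
      (sym (sumFin-+ (f zero) (λ j → sumFin (λ i → f (suc i) j))))

    sumFin-const : ∀ {m} (c : ℚ) → sumFin {m} (λ _ → c) ≡ fromℕ m * c
    sumFin-const {zero}  c = sym (ℚ.*-zeroˡ c)
    sumFin-const {suc m} c = trans (cong (λ s → c + s) (sumFin-const {m} c)) (distrib-1+ (fromℕ m) c)

    sumFin-δˡ : ∀ {m} (i : Fin m) (f : Fin m → ℚ) → sumFin (λ k → δ i k * f k) ≡ f i
    sumFin-δˡ zero f = begin
      1ℚ * f zero + sumFin (λ k → 0ℚ * f (suc k))  ≡⟨ cong₂ _+_ (ℚ.*-identityˡ (f zero)) (sumFin-zero (λ k → ℚ.*-zeroˡ (f (suc k)))) ⟩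
      f zero + 0ℚ                                  ≡⟨ ℚ.+-identityʳ (f zero) ⟩
      f zero                                       ∎
    sumFin-δˡ (suc i) f = begin
      0ℚ * f zero + sumFin (λ k → δ i k * f (suc k))  ≡⟨ cong₂ _+_ (ℚ.*-zeroˡ (f zero)) (sumFin-δˡ i (λ k → f (suc k))) ⟩
      0ℚ + f (suc i)                                  ≡⟨ ℚ.+-identityˡ (f (suc i)) ⟩
      f (suc i)                                       ∎

    sumFin-δʳ : ∀ {m} (j : Fin m) (f : Fin m → ℚ) → sumFin (λ k → f k * δ k j) ≡ f j
    sumFin-δʳ zero f = begin
      f zero * 1ℚ + sumFin (λ k → f (suc k) * 0ℚ)  ≡⟨ cong₂ _+_ (ℚ.*-identityʳ (f zero)) (sumFin-zero (λ k → ℚ.*-zeroʳ (f (suc k)))) ⟩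
      f zero + 0ℚ                                  ≡⟨ ℚ.+-identityʳ (f zero) ⟩
      f zero                                       ∎
    sumFin-δʳ (suc j) f = begin
      f zero * 0ℚ + sumFin (λ k → f (suc k) * δ k j)  ≡⟨ cong₂ _+_ (ℚ.*-zeroʳ (f zero)) (sumFin-δʳ j (λ k → f (suc k))) ⟩
      0ℚ + f (suc j)                                  ≡⟨ ℚ.+-identityˡ (f (suc j)) ⟩
      f (suc j)                                       ∎

    sumFin-δ-const : ∀ {m} (i : Fin m) (c : ℚ) → sumFin (λ k → δ i k - c) ≡ 1ℚ - fromℕ m * c
    sumFin-δ-const {m} i c = begin
      sumFin (λ k → δ i k - c)                    ≡⟨ sumFin-- (δ i) (λ _ → c) ⟩
      sumFin (δ i) - sumFin {m} (λ _ → c)         ≡⟨ cong₂ _-_ row (sumFin-const {m} c) ⟩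
      1ℚ - fromℕ m * c                            ∎
      where
      row : sumFin (δ i) ≡ 1ℚ
      row = trans (sumFin-cong (λ k → sym (ℚ.*-identityʳ (δ i k)))) (sumFin-δˡ i (λ _ → 1ℚ))

    sumFin-const-δ : ∀ {m} (j : Fin m) (c : ℚ) → sumFin (λ k → δ k j - c) ≡ 1ℚ - fromℕ m * c
    sumFin-const-δ {m} j c = begin
      sumFin (λ k → δ k j - c)                    ≡⟨ sumFin-- (λ k → δ k j) (λ _ → c) ⟩
      sumFin (λ k → δ k j) - sumFin {m} (λ _ → c) ≡⟨ cong₂ _-_ column (sumFin-const {m} c) ⟩
      1ℚ - fromℕ m * c                            ∎
      where
      column : sumFin (λ k → δ k j) ≡ 1ℚ
      column = trans (sumFin-cong (λ k → sym (ℚ.*-identityˡ (δ k j)))) (sumFin-δʳ j (λ _ → 1ℚ))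

  sumBelow : ℕ → (ℕ → ℚ) → ℚ
  sumBelow zero    f = 0ℚ
  sumBelow (suc m) f = f 0 + sumBelow m (λ k → f (suc k))

  sumFin-toℕ : ∀ {m} (f : ℕ → ℚ) → sumFin {m} (λ k → f (toℕ k)) ≡ sumBelow m f
  sumFin-toℕ {zero}  f = refl
  sumFin-toℕ {suc m} f = cong (λ s → f 0 + s) (sumFin-toℕ {m} (λ k → f (suc k)))

  sumBelow-+ : ∀ a b (f : ℕ → ℚ) → sumBelow (a ℕ.+ b) f ≡ sumBelow a f + sumBelow b (λ k → f (a ℕ.+ k))
  sumBelow-+ zero    b f = sym (ℚ.+-identityˡ _)
  sumBelow-+ (suc a) b f = trans (cong (λ s → f 0 + s) (sumBelow-+ a b (λ k → f (suc k)))) (sym (ℚ.+-assoc (f 0) _ _))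

  sumBelow-const : ∀ a (f : ℕ → ℚ) {c} → (∀ k → k ℕ.< a → f k ≡ c) → sumBelow a f ≡ fromℕ a * c
  sumBelow-const zero    f {c} f≡c = sym (ℚ.*-zeroˡ c)
  sumBelow-const (suc a) f {c} f≡c =
    trans (cong₂ _+_ (f≡c 0 (s≤s z≤n)) (sumBelow-const a (λ k → f (suc k)) (λ k k<a → f≡c (suc k) (s≤s k<a))))
          (distrib-1+ (fromℕ a) c)

  ≡ᵇ-sym : ∀ a b → (a ≡ᵇ b) ≡ (b ≡ᵇ a)
  ≡ᵇ-sym zero    zero    = refl
  ≡ᵇ-sym zero    (suc b) = refl
  ≡ᵇ-sym (suc a) zero    = refl
  ≡ᵇ-sym (suc a) (suc b) = ≡ᵇ-sym a b

  ≡ᵇ-refl : ∀ a → (a ≡ᵇ a) ≡ true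
  ≡ᵇ-refl zero    = refl
  ≡ᵇ-refl (suc a) = ≡ᵇ-refl a

  ≡ᵇ-false : ∀ {a b} → a ≢ b → (a ≡ᵇ b) ≡ false
  ≡ᵇ-false {zero}  {zero}  a≢b = ⊥-elim (a≢b refl)
  ≡ᵇ-false {zero}  {suc b} _   = refl
  ≡ᵇ-false {suc a} {zero}  _   = refl
  ≡ᵇ-false {suc a} {suc b} a≢b = ≡ᵇ-false (λ a≡b → a≢b (cong suc a≡b))

  δ-sym : ∀ {m} (i j : Fin m) → δ i j ≡ δ j i
  δ-sym i j = cong b2q (≡ᵇ-sym (toℕ i) (toℕ j))

  infix 4 _≈ᴹ_
  _≈ᴹ_ : ∀ {m} → Mat m → Mat m → Set
  M ≈ᴹ N = ∀ i j → M i j ≡ N i j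

  ≈ᴹ-setoid : ℕ → Setoid 0ℓ 0ℓ
  ≈ᴹ-setoid m = record
    { Carrier       = Mat m
    ; _≈_           = _≈ᴹ_
    ; isEquivalence = record
      { refl  = λ _ _ → refl
      ; sym   = λ M≈N i j → sym (M≈N i j)
      ; trans = λ M≈N N≈O i j → trans (M≈N i j) (N≈O i j)
      }
    }

  grounded : ∀ {m} → Fin m → Mat m
  grounded a i j = δ i j - δ i a

  centring : ∀ {m} → ℚ → Mat m
  centring t i j = δ i j - t

  resistance-cong : ∀ {m} {M N : Mat m} → M ≈ᴹ N → ∀ i j → resistance M i j ≡ resistance N i j
  resistance-cong M≈N i j = cong₂ _-_ (cong₂ _+_ (M≈N i i) (M≈N j j)) (cong (2ℚ *_) (M≈N i j))

  module _ where
    open ≡-Reasoning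

    ⊗-assoc : ∀ {m} (A B C : Mat m) → (A ⊗ B) ⊗ C ≈ᴹ A ⊗ (B ⊗ C)
    ⊗-assoc A B C i j = begin
      sumFin (λ k → sumFin (λ l → A i l * B l k) * C k j)      ≡⟨ sumFin-cong (λ k → sumFin-*ʳ (C k j) (λ l → A i l * B l k)) ⟨
      sumFin (λ k → sumFin (λ l → A i l * B l k * C k j))      ≡⟨ sumFin-comm (λ k l → A i l * B l k * C k j) ⟩
      sumFin (λ l → sumFin (λ k → A i l * B l k * C k j))      ≡⟨ sumFin-cong (λ l → sumFin-cong (λ k → ℚ.*-assoc (A i l) (B l k) (C k j))) ⟩
      sumFin (λ l → sumFin (λ k → A i l * (B l k * C k j)))    ≡⟨ sumFin-cong (λ l → sumFin-*ˡ (A i l) (λ k → B l k * C k j)) ⟩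
      sumFin (λ l → A i l * sumFin (λ k → B l k * C k j))      ∎

    ⊗-congˡ : ∀ {m} (A : Mat m) {B C : Mat m} → B ≈ᴹ C → A ⊗ B ≈ᴹ A ⊗ C
    ⊗-congˡ A B≈C i j = sumFin-cong (λ k → cong (λ x → A i k * x) (B≈C k j))

    ⊗-congʳ : ∀ {m} (A : Mat m) {B C : Mat m} → B ≈ᴹ C → B ⊗ A ≈ᴹ C ⊗ A
    ⊗-congʳ A B≈C i j = sumFin-cong (λ k → cong (λ x → x * A k j) (B≈C i k))

    ⊗-centringʳ : ∀ {m} (M : Mat m) (t : ℚ) i j → (M ⊗ centring t) i j ≡ M i j - sumFin (M i) * t
    ⊗-centringʳ M t i j = begin
      sumFin (λ k → M i k * (δ k j - t))                        ≡⟨ sumFin-cong (λ k → *-distribˡ-- (M i k) (δ k j) t) ⟩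
      sumFin (λ k → M i k * δ k j - M i k * t)                  ≡⟨ sumFin-- (λ k → M i k * δ k j) (λ k → M i k * t) ⟩
      sumFin (λ k → M i k * δ k j) - sumFin (λ k → M i k * t)   ≡⟨ cong₂ _-_ (sumFin-δʳ j (M i)) (sumFin-*ʳ t (M i)) ⟩
      M i j - sumFin (M i) * t                                  ∎

    centring-⊗ : ∀ {m} (M : Mat m) (t : ℚ) i j → (centring t ⊗ M) i j ≡ M i j - t * sumFin (λ k → M k j)
    centring-⊗ M t i j = begin
      sumFin (λ k → (δ i k - t) * M k j)                        ≡⟨ sumFin-cong (λ k → *-distribʳ-- (M k j) (δ i k) t) ⟩
      sumFin (λ k → δ i k * M k j - t * M k j)                  ≡⟨ sumFin-- (λ k → δ i k * M k j) (λ k → t * M k j) ⟩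
      sumFin (λ k → δ i k * M k j) - sumFin (λ k → t * M k j)   ≡⟨ cong₂ _-_ (sumFin-δˡ i (λ k → M k j)) (sumFin-*ˡ t (λ k → M k j)) ⟩
      M i j - t * sumFin (λ k → M k j)                          ∎

  module _ {m : ℕ} where
    open SetoidReasoning (≈ᴹ-setoid m)

    groupInverse-unique : {L X X′ : Mat m} → IsGroupInverse L X → IsGroupInverse L X′ → X ≈ᴹ X′
    groupInverse-unique {L} {X} {X′} (LXL≈L , XLX≈X , LX≈XL) (LX′L≈L , X′LX′≈X′ , LX′≈X′L) = begin
      X                  ≈⟨ XLX≈X ⟨
      (X ⊗ L) ⊗ X        ≈⟨ ⊗-assoc X L X ⟩
      X ⊗ (L ⊗ X)        ≈⟨ ⊗-congˡ X LX≈LX′ ⟩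
      X ⊗ (L ⊗ X′)       ≈⟨ ⊗-assoc X L X′ ⟨
      (X ⊗ L) ⊗ X′       ≈⟨ ⊗-congʳ X′ LX≈XL ⟨
      (L ⊗ X) ⊗ X′       ≈⟨ ⊗-congʳ X′ LX≈LX′ ⟩
      (L ⊗ X′) ⊗ X′      ≈⟨ ⊗-congʳ X′ LX′≈X′L ⟩
      (X′ ⊗ L) ⊗ X′      ≈⟨ X′LX′≈X′ ⟩
      X′                 ∎
      where
      -- both L X and L X′ equal (L X′)(L X)
      LX≈LX′ : L ⊗ X ≈ᴹ L ⊗ X′
      LX≈LX′ = begin
        L ⊗ X                    ≈⟨ ⊗-congʳ X LX′L≈L ⟨
        ((L ⊗ X′) ⊗ L) ⊗ X       ≈⟨ ⊗-assoc (L ⊗ X′) L X ⟩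
        (L ⊗ X′) ⊗ (L ⊗ X)       ≈⟨ ⊗-congʳ (L ⊗ X) LX′≈X′L ⟩
        (X′ ⊗ L) ⊗ (L ⊗ X)       ≈⟨ ⊗-congˡ (X′ ⊗ L) LX≈XL ⟩
        (X′ ⊗ L) ⊗ (X ⊗ L)       ≈⟨ ⊗-assoc X′ L (X ⊗ L) ⟩
        X′ ⊗ (L ⊗ (X ⊗ L))       ≈⟨ ⊗-congˡ X′ (⊗-assoc L X L) ⟨
        X′ ⊗ ((L ⊗ X) ⊗ L)       ≈⟨ ⊗-congˡ X′ LXL≈L ⟩
        X′ ⊗ L                   ≈⟨ LX′≈X′L ⟨
        L ⊗ X′                   ∎

  module _ where
    open ≡-Reasoning

    laplacian-action : ∀ {m} (W : Mat m) (f : Fin m → ℚ) i →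
      sumFin (λ k → ((if toℕ i ≡ᵇ toℕ k then sumFin (W i) else 0ℚ) - W i k) * f k)
        ≡ sumFin (λ k → W i k * (f i - f k))
    laplacian-action W f i = begin
      sumFin (λ k → ((if toℕ i ≡ᵇ toℕ k then D else 0ℚ) - W i k) * f k)   ≡⟨ sumFin-cong (λ k → split (toℕ i ≡ᵇ toℕ k) D (W i k) (f k)) ⟩
      sumFin (λ k → δ i k * (D * f k) - W i k * f k)                      ≡⟨ sumFin-- (λ k → δ i k * (D * f k)) (λ k → W i k * f k) ⟩
      sumFin (λ k → δ i k * (D * f k)) - sumFin (λ k → W i k * f k)       ≡⟨ cong (λ s → s - sumFin (λ k → W i k * f k)) (sumFin-δˡ i (λ k → D * f k)) ⟩
      D * f i - sumFin (λ k → W i k * f k)                                ≡⟨ cong (λ s → s - sumFin (λ k → W i k * f k)) (sumFin-*ʳ (f i) (W i)) ⟨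
      sumFin (λ k → W i k * f i) - sumFin (λ k → W i k * f k)             ≡⟨ sumFin-- (λ k → W i k * f i) (λ k → W i k * f k) ⟨
      sumFin (λ k → W i k * f i - W i k * f k)                            ≡⟨ sumFin-cong (λ k → *-distribˡ-- (W i k) (f i) (f k)) ⟨
      sumFin (λ k → W i k * (f i - f k))                                  ∎
      where
      D = sumFin (W i)
      split : ∀ b D x y → ((if b then D else 0ℚ) - x) * y ≡ b2q b * (D * y) - x * y
      split true  = on-diagonal
        where
        on-diagonal : ∀ D x y → (D - x) * y ≡ 1ℚ * (D * y) - x * y
        on-diagonal = solve-∀ ℚ-ring
      split false = off-diagonal
        where
        off-diagonal : ∀ D x y → (0ℚ - x) * y ≡ 0ℚ * (D * y) - x * y
        off-diagonal = solve-∀ ℚ-ring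


  module GroundedInverse {m} (L Y : Mat m) (a : Fin m) (t : ℚ) (m*t≡1 : fromℕ m * t ≡ 1ℚ)
    (L-sym : ∀ i j → L i j ≡ L j i) (L-rowSum : ∀ i → sumFin (L i) ≡ 0ℚ)
    (Y-sym : ∀ i j → Y i j ≡ Y j i) (LY≈grounded : L ⊗ Y ≈ᴹ grounded a) where

    H : Mat m
    H = centring t

    X : Mat m
    X = (H ⊗ Y) ⊗ H

    module _ where
      open ≡-Reasoning

      recentre : ∀ x y → (x - y) - t * (1ℚ - fromℕ m * y) ≡ x - t
      recentre x y = begin
        (x - y) - t * (1ℚ - fromℕ m * y)   ≡⟨ expand x y t (fromℕ m) ⟩
        x - t + y * (fromℕ m * t - 1ℚ)     ≡⟨ cong (λ s → x - t + y * (s - 1ℚ)) m*t≡1 ⟩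
        x - t + y * (1ℚ - 1ℚ)              ≡⟨ cancel x t y ⟩
        x - t                              ∎
        where
        expand : ∀ x y t M → (x - y) - t * (1ℚ - M * y) ≡ x - t + y * (M * t - 1ℚ)
        expand = solve-∀ ℚ-ring
        cancel : ∀ x t y → x - t + y * (1ℚ - 1ℚ) ≡ x - t
        cancel = solve-∀ ℚ-ring

      minus-0* : ∀ x s → x - 0ℚ * s ≡ x
      minus-0* = solve-∀ ℚ-ring

      minus-*0 : ∀ x s → x - s * 0ℚ ≡ x
      minus-*0 = solve-∀ ℚ-ring

      L-columnSum : ∀ j → sumFin (λ k → L k j) ≡ 0ℚ
      L-columnSum j = trans (sumFin-cong (λ k → L-sym k j)) (L-rowSum j)

      L⊗H≈L : L ⊗ H ≈ᴹ L
      L⊗H≈L i j = begin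
        (L ⊗ H) i j                  ≡⟨ ⊗-centringʳ L t i j ⟩
        L i j - sumFin (L i) * t     ≡⟨ cong (λ s → L i j - s * t) (L-rowSum i) ⟩
        L i j - 0ℚ * t               ≡⟨ minus-0* (L i j) t ⟩
        L i j                        ∎

      H⊗L≈L : H ⊗ L ≈ᴹ L
      H⊗L≈L i j = begin
        (H ⊗ L) i j                          ≡⟨ centring-⊗ L t i j ⟩
        L i j - t * sumFin (λ k → L k j)     ≡⟨ cong (λ s → L i j - t * s) (L-columnSum j) ⟩
        L i j - t * 0ℚ                       ≡⟨ minus-*0 (L i j) t ⟩
        L i j                                ∎

      grounded⊗H≈H : grounded a ⊗ H ≈ᴹ H
      grounded⊗H≈H i j = begin
        (grounded a ⊗ H) i j                                 ≡⟨ ⊗-centringʳ (grounded a) t i j ⟩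
        (δ i j - δ i a) - sumFin (grounded a i) * t          ≡⟨ cong (λ s → (δ i j - δ i a) - s * t) (sumFin-δ-const i (δ i a)) ⟩
        (δ i j - δ i a) - (1ℚ - fromℕ m * δ i a) * t         ≡⟨ cong (λ s → (δ i j - δ i a) - s) (ℚ.*-comm _ t) ⟩
        (δ i j - δ i a) - t * (1ℚ - fromℕ m * δ i a)         ≡⟨ recentre (δ i j) (δ i a) ⟩
        H i j                                                ∎

      Y⊗L≈groundedᵀ : Y ⊗ L ≈ᴹ λ i j → grounded a j i
      Y⊗L≈groundedᵀ i j = begin
        sumFin (λ k → Y i k * L k j)     ≡⟨ sumFin-cong (λ k → trans (cong₂ _*_ (Y-sym i k) (L-sym k j)) (ℚ.*-comm (Y k i) (L j k))) ⟩
        sumFin (λ k → L j k * Y k i)     ≡⟨ LY≈grounded j i ⟩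
        grounded a j i                   ∎

      H⊗groundedᵀ≈H : H ⊗ (λ i j → grounded a j i) ≈ᴹ H
      H⊗groundedᵀ≈H i j = begin
        (H ⊗ (λ i j → grounded a j i)) i j                    ≡⟨ centring-⊗ (λ i j → grounded a j i) t i j ⟩
        (δ j i - δ j a) - t * sumFin (λ k → δ j k - δ j a)    ≡⟨ cong (λ s → (δ j i - δ j a) - t * s) (sumFin-δ-const j (δ j a)) ⟩
        (δ j i - δ j a) - t * (1ℚ - fromℕ m * δ j a)          ≡⟨ recentre (δ j i) (δ j a) ⟩
        δ j i - t                                             ≡⟨ cong (λ s → s - t) (δ-sym j i) ⟩
        H i j                                                 ∎

      H⊗H≈H : H ⊗ H ≈ᴹ H
      H⊗H≈H i j = begin
        (H ⊗ H) i j                                  ≡⟨ centring-⊗ H t i j ⟩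
        (δ i j - t) - t * sumFin (λ k → δ k j - t)   ≡⟨ cong (λ s → (δ i j - t) - t * s) (sumFin-const-δ j t) ⟩
        (δ i j - t) - t * (1ℚ - fromℕ m * t)         ≡⟨ recentre (δ i j) t ⟩
        H i j                                        ∎

      colSum : Fin m → ℚ
      colSum j = sumFin (λ k → Y k j)

      X-entry : ∀ i j → X i j ≡ (Y i j - t * colSum j) - (colSum i - t * sumFin colSum) * t
      X-entry i j = begin
        X i j                                                          ≡⟨ ⊗-centringʳ (H ⊗ Y) t i j ⟩
        (H ⊗ Y) i j - sumFin ((H ⊗ Y) i) * t                           ≡⟨ cong₂ (λ x s → x - s * t) (centring-⊗ Y t i j) row ⟩
        (Y i j - t * colSum j) - (colSum i - t * sumFin colSum) * t    ∎
        where
        row : sumFin ((H ⊗ Y) i) ≡ colSum i - t * sumFin colSum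
        row = begin
          sumFin (λ k → (H ⊗ Y) i k)                  ≡⟨ sumFin-cong (centring-⊗ Y t i) ⟩
          sumFin (λ k → Y i k - t * colSum k)         ≡⟨ sumFin-- (Y i) (λ k → t * colSum k) ⟩
          sumFin (Y i) - sumFin (λ k → t * colSum k)  ≡⟨ cong₂ _-_ (sumFin-cong (Y-sym i)) (sumFin-*ˡ t colSum) ⟩
          colSum i - t * sumFin colSum                ∎

      resistance-X : ∀ i j → resistance X i j ≡ resistance Y i j
      resistance-X i j =
        trans (cong₂ _-_ (cong₂ _+_ (X-entry i i) (X-entry j j)) (cong (2ℚ *_) (X-entry i j)))
              (shifts-cancel (Y i i) (Y j j) (Y i j) (colSum i) (colSum j) (sumFin colSum) t)
        where
        shifts-cancel : ∀ yii yjj yij ci cj S t →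
          ((yii - t * ci) - (ci - t * S) * t) + ((yjj - t * cj) - (cj - t * S) * t)
            - 2ℚ * ((yij - t * cj) - (ci - t * S) * t) ≡ yii + yjj - 2ℚ * yij
        shifts-cancel = solve-∀ ℚ-ring

    module _ where
      open SetoidReasoning (≈ᴹ-setoid m)

      L⊗X≈H : L ⊗ X ≈ᴹ H
      L⊗X≈H = begin
        L ⊗ ((H ⊗ Y) ⊗ H)      ≈⟨ ⊗-assoc L (H ⊗ Y) H ⟨
        (L ⊗ (H ⊗ Y)) ⊗ H      ≈⟨ ⊗-congʳ H (⊗-assoc L H Y) ⟨
        ((L ⊗ H) ⊗ Y) ⊗ H      ≈⟨ ⊗-congʳ H (⊗-congʳ Y L⊗H≈L) ⟩
        (L ⊗ Y) ⊗ H            ≈⟨ ⊗-congʳ H LY≈grounded ⟩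
        grounded a ⊗ H         ≈⟨ grounded⊗H≈H ⟩
        H                      ∎

      X⊗L≈H : X ⊗ L ≈ᴹ H
      X⊗L≈H = begin
        ((H ⊗ Y) ⊗ H) ⊗ L                ≈⟨ ⊗-assoc (H ⊗ Y) H L ⟩
        (H ⊗ Y) ⊗ (H ⊗ L)                ≈⟨ ⊗-congˡ (H ⊗ Y) H⊗L≈L ⟩
        (H ⊗ Y) ⊗ L                      ≈⟨ ⊗-assoc H Y L ⟩
        H ⊗ (Y ⊗ L)                      ≈⟨ ⊗-congˡ H Y⊗L≈groundedᵀ ⟩
        H ⊗ (λ i j → grounded a j i)     ≈⟨ H⊗groundedᵀ≈H ⟩
        H                                ∎

      X-isGroupInverse : IsGroupInverse L X
      X-isGroupInverse = LXL≈L , XLX≈X , LX≈XL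
        where
        LXL≈L : (L ⊗ X) ⊗ L ≈ᴹ L
        LXL≈L = begin
          (L ⊗ X) ⊗ L   ≈⟨ ⊗-congʳ L L⊗X≈H ⟩
          H ⊗ L         ≈⟨ H⊗L≈L ⟩
          L             ∎
        XLX≈X : (X ⊗ L) ⊗ X ≈ᴹ X
        XLX≈X = begin
          (X ⊗ L) ⊗ X                ≈⟨ ⊗-congʳ X X⊗L≈H ⟩
          H ⊗ ((H ⊗ Y) ⊗ H)          ≈⟨ ⊗-assoc H (H ⊗ Y) H ⟨
          (H ⊗ (H ⊗ Y)) ⊗ H          ≈⟨ ⊗-congʳ H (⊗-assoc H H Y) ⟨
          ((H ⊗ H) ⊗ Y) ⊗ H          ≈⟨ ⊗-congʳ H (⊗-congʳ Y H⊗H≈H) ⟩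
          X                          ∎
        LX≈XL : L ⊗ X ≈ᴹ X ⊗ L
        LX≈XL = begin
          L ⊗ X   ≈⟨ L⊗X≈H ⟩
          H       ≈⟨ X⊗L≈H ⟨
          X ⊗ L   ∎

    resistance-groupInverse : ∀ {X′} → IsGroupInverse L X′ → ∀ i j → resistance X′ i j ≡ resistance Y i j
    resistance-groupInverse X′-isGroupInverse i j =
      trans (resistance-cong (groupInverse-unique X′-isGroupInverse X-isGroupInverse) i j) (resistance-X i j)

  kindAdj : Kind → Kind → Bool
  kindAdj K K′ = adjK K K′ ∨ (inKn K ∧ inKn K′)

  kindAdj-sym : ∀ K K′ → kindAdj K K′ ≡ kindAdj K′ K
  kindAdj-sym vA vA = refl
  kindAdj-sym vA vP = refl
  kindAdj-sym vA vQ = refl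
  kindAdj-sym vA vN = refl
  kindAdj-sym vP vA = refl
  kindAdj-sym vP vP = refl
  kindAdj-sym vP vQ = refl
  kindAdj-sym vP vN = refl
  kindAdj-sym vQ vA = refl
  kindAdj-sym vQ vP = refl
  kindAdj-sym vQ vQ = refl
  kindAdj-sym vQ vN = refl
  kindAdj-sym vN vA = refl
  kindAdj-sym vN vP = refl
  kindAdj-sym vN vQ = refl
  kindAdj-sym vN vN = refl

  atA : Kind → ℚ
  atA vA = 1ℚ
  atA _  = 0ℚ

  b2q-∧-not : ∀ x e → b2q (x ∧ not e) ≡ b2q x - b2q e * b2q x
  b2q-∧-not true  true  = refl
  b2q-∧-not true  false = refl
  b2q-∧-not false true  = refl
  b2q-∧-not false false = refl

  adj-kinds : ∀ p q i k → adj p q i k ≡ kindAdj (kind p q i) (kind p q k) ∧ not (i ≡ᵇ k)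
  adj-kinds p q i k with i ℕ.≟ k
  ... | yes refl = loop (kind p q i) (i ≡ᵇ i)
    where
    loop : ∀ K b → (if adjK K K then true else (if inKn K then (if inKn K then not b else false) else false))
                     ≡ kindAdj K K ∧ not b
    loop vA b = refl
    loop vP b = refl
    loop vQ b = refl
    loop vN b = refl
  ... | no i≢k = edge (kind p q i) (kind p q k) (≡ᵇ-false i≢k)
    where
    edge : ∀ K K′ {b} → b ≡ false → (if adjK K K′ then true else (if inKn K then (if inKn K′ then not b else false) else false))
                                     ≡ kindAdj K K′ ∧ not b
    edge K K′ refl with adjK K K′ | inKn K | inKn K′
    ... | true  | _     | _     = refl
    ... | false | true  | true  = refl
    ... | false | true  | false = refl
    ... | false | false | _     = refl

  adj-irrefl : ∀ p q i → adj p q i i ≡ false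
  adj-irrefl p q i = trans (adj-kinds p q i i) (trans (cong (λ b → K ∧ not b) (≡ᵇ-refl i)) (∧-zeroʳ K))
    where K = kindAdj (kind p q i) (kind p q i)

  adj-offDiagonal : ∀ p q {i k} → i ≢ k → adj p q i k ≡ kindAdj (kind p q i) (kind p q k)
  adj-offDiagonal p q {i} {k} i≢k = trans (adj-kinds p q i k) (trans (cong (λ b → K ∧ not b) (≡ᵇ-false i≢k)) (∧-identityʳ K))
    where K = kindAdj (kind p q i) (kind p q k)

  kind-vA : ∀ p q k → kind p q k ≡ vA → k ≡ 0
  kind-vA p q zero    _ = refl
  kind-vA p q (suc k) kind≡vA with suc k <ᵇ p | suc k <ᵇ p ℕ.+ q
  kind-vA p q (suc k) () | true  | _
  kind-vA p q (suc k) () | false | true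
  kind-vA p q (suc k) () | false | false

  atA-kind : ∀ p q k → b2q (k ≡ᵇ 0) ≡ atA (kind p q k)
  atA-kind p q zero = refl
  atA-kind p q (suc k) with suc k <ᵇ p | suc k <ᵇ p ℕ.+ q
  ... | true  | _     = refl
  ... | false | true  = refl
  ... | false | false = refl

  kind-vP : ∀ p₀ q k → k ℕ.< p₀ → kind (suc p₀) q (suc k) ≡ vP
  kind-vP p₀ q k k<p₀ with k <ᵇ p₀ | ℕ.<⇒<ᵇ k<p₀
  ... | true | _ = refl

  kind-vQ : ∀ p₀ q k → k ℕ.< q → kind (suc p₀) q (suc (p₀ ℕ.+ k)) ≡ vQ
  kind-vQ p₀ q k k<q with p₀ ℕ.+ k <ᵇ p₀ | ℕ.<ᵇ⇒< (p₀ ℕ.+ k) p₀ | p₀ ℕ.+ k <ᵇ p₀ ℕ.+ q | ℕ.<⇒<ᵇ (ℕ.+-monoʳ-< p₀ k<q)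
  ... | true  | p₀+k<p₀ | _    | _ = ⊥-elim (ℕ.≤⇒≯ (ℕ.m≤m+n p₀ k) (p₀+k<p₀ tt))
  ... | false | _       | true | _ = refl

  kind-vN : ∀ p₀ q k → kind (suc p₀) q (suc (p₀ ℕ.+ q ℕ.+ k)) ≡ vN
  kind-vN p₀ q k with p₀ ℕ.+ q ℕ.+ k <ᵇ p₀ | ℕ.<ᵇ⇒< (p₀ ℕ.+ q ℕ.+ k) p₀ | p₀ ℕ.+ q ℕ.+ k <ᵇ p₀ ℕ.+ q | ℕ.<ᵇ⇒< (p₀ ℕ.+ q ℕ.+ k) (p₀ ℕ.+ q)
  ... | true  | <p₀ | _     | _      = ⊥-elim (ℕ.≤⇒≯ (ℕ.≤-trans (ℕ.m≤m+n p₀ q) (ℕ.m≤m+n (p₀ ℕ.+ q) k)) (<p₀ tt))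
  ... | false | _   | true  | <p₀+q  = ⊥-elim (ℕ.≤⇒≯ (ℕ.m≤m+n (p₀ ℕ.+ q) k) (<p₀+q tt))
  ... | false | _   | false | _      = refl

  -- A = |P ∖ {a}|, B = |Q|, C = |N|, and u = 1/q, v = 1/p, w = 1/n.
  module Blocks (A B C u v w : ℚ) (hu : B * u ≡ 1ℚ) (hv : (1ℚ + A) * v ≡ 1ℚ) (hw : (1ℚ + C) * w ≡ 1ℚ) where
    open ≡-Reasoning

    count : (Kind → ℚ) → ℚ
    count h = h vA + A * h vP + B * h vQ + C * h vN

    neighbourSum : Kind → (Kind → ℚ) → ℚ
    neighbourSum vA h = B * h vQ + C * h vN
    neighbourSum vP h = B * h vQ
    neighbourSum vQ h = h vA + A * h vP
    neighbourSum vN h = h vA + (C - 1ℚ) * h vN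

    deg : Kind → ℚ
    deg K = neighbourSum K (λ _ → 1ℚ)

    -- kindAdj makes a and each vertex of N adjacent to itself; the subtracted term removes that loop.
    count-kindAdj : ∀ K h → count (λ K′ → b2q (kindAdj K K′) * h K′) - b2q (kindAdj K K) * h K ≡ neighbourSum K h
    count-kindAdj vA h = simplify A B C (h vA) (h vP) (h vQ) (h vN)
      where
      simplify : ∀ A B C a x y z → 1ℚ * a + A * (0ℚ * x) + B * (1ℚ * y) + C * (1ℚ * z) - 1ℚ * a ≡ B * y + C * z
      simplify = solve-∀ ℚ-ring
    count-kindAdj vP h = simplify A B C (h vA) (h vP) (h vQ) (h vN)
      where
      simplify : ∀ A B C a x y z → 0ℚ * a + A * (0ℚ * x) + B * (1ℚ * y) + C * (0ℚ * z) - 0ℚ * x ≡ B * y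
      simplify = solve-∀ ℚ-ring
    count-kindAdj vQ h = simplify A B C (h vA) (h vP) (h vQ) (h vN)
      where
      simplify : ∀ A B C a x y z → 1ℚ * a + A * (1ℚ * x) + B * (0ℚ * y) + C * (0ℚ * z) - 0ℚ * y ≡ a + A * x
      simplify = solve-∀ ℚ-ring
    count-kindAdj vN h = simplify A B C (h vA) (h vP) (h vQ) (h vN)
      where
      simplify : ∀ A B C a x y z → 1ℚ * a + A * (0ℚ * x) + B * (0ℚ * y) + C * (1ℚ * z) - 1ℚ * z ≡ a + (C - 1ℚ) * z
      simplify = solve-∀ ℚ-ring

    -- Y i j = y₀ (kind i) (kind j) + δ i j * y₁ (kind j) inverts L away from a: on N the reduced
    -- Laplacian is n I − 1 1ᵀ, with inverse (I + 1 1ᵀ)/n, and similarly on (P ∖ {a}) ∪ Q.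
    y₀ : Kind → Kind → ℚ
    y₀ vP vP = u
    y₀ vP vQ = u
    y₀ vQ vP = u
    y₀ vQ vQ = u - u * v
    y₀ vN vN = w
    y₀ _  _  = 0ℚ

    y₁ : Kind → ℚ
    y₁ vA = 0ℚ
    y₁ vP = u
    y₁ vQ = v
    y₁ vN = w

    y₀-sym : ∀ K K′ → y₀ K K′ ≡ y₀ K′ K
    y₀-sym vA vA = refl
    y₀-sym vA vP = refl
    y₀-sym vA vQ = refl
    y₀-sym vA vN = refl
    y₀-sym vP vA = refl
    y₀-sym vP vP = refl
    y₀-sym vP vQ = refl
    y₀-sym vP vN = refl
    y₀-sym vQ vA = refl
    y₀-sym vQ vP = refl
    y₀-sym vQ vQ = refl
    y₀-sym vQ vN = refl
    y₀-sym vN vA = refl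
    y₀-sym vN vP = refl
    y₀-sym vN vQ = refl
    y₀-sym vN vN = refl

    LY-diagonal : ∀ K → neighbourSum K (λ K′ → y₀ K K - y₀ K′ K) + deg K * y₁ K ≡ 1ℚ - atA K
    LY-diagonal vA = begin
      B * (0ℚ - 0ℚ) + C * (0ℚ - 0ℚ) + (B * 1ℚ + C * 1ℚ) * 0ℚ    ≡⟨ solve (B ∷ C ∷ []) ℚ-ring ⟩
      1ℚ - 1ℚ                                                 ∎
    LY-diagonal vP = begin
      B * (u - u) + B * 1ℚ * u                                ≡⟨ solve (B ∷ u ∷ []) ℚ-ring ⟩
      B * u                                                   ≡⟨ hu ⟩
      1ℚ - 0ℚ                                                 ∎
    LY-diagonal vQ = begin
      (u - u * v - 0ℚ) + A * (u - u * v - u) + (1ℚ + A * 1ℚ) * v   ≡⟨ solve (A ∷ u ∷ v ∷ []) ℚ-ring ⟩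
      u - ((1ℚ + A) * v) * u + (1ℚ + A) * v                       ≡⟨ cong (λ x → u - x * u + x) hv ⟩
      u - 1ℚ * u + 1ℚ                                             ≡⟨ solve (u ∷ []) ℚ-ring ⟩
      1ℚ - 0ℚ                                                     ∎
    LY-diagonal vN = begin
      (w - 0ℚ) + (C - 1ℚ) * (w - w) + (1ℚ + (C - 1ℚ) * 1ℚ) * w    ≡⟨ solve (C ∷ w ∷ []) ℚ-ring ⟩
      (1ℚ + C) * w                                                ≡⟨ hw ⟩
      1ℚ - 0ℚ                                                     ∎

    LY-offDiagonal : ∀ K K′ → (K ≡ vA → K′ ≡ vA → ⊥) →
      neighbourSum K (λ K″ → y₀ K K′ - y₀ K″ K′) + (0ℚ - b2q (kindAdj K K′)) * y₁ K′ ≡ 0ℚ - atA K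
    LY-offDiagonal vA vA both-a = ⊥-elim (both-a refl refl)
    LY-offDiagonal vP vA _ = begin
      B * (0ℚ - 0ℚ) + (0ℚ - 0ℚ) * 0ℚ                              ≡⟨ solve (B ∷ []) ℚ-ring ⟩
      0ℚ - 0ℚ                                                     ∎
    LY-offDiagonal vQ vA _ = begin
      (0ℚ - 0ℚ) + A * (0ℚ - 0ℚ) + (0ℚ - 1ℚ) * 0ℚ                   ≡⟨ solve (A ∷ []) ℚ-ring ⟩
      0ℚ - 0ℚ                                                     ∎
    LY-offDiagonal vN vA _ = begin
      (0ℚ - 0ℚ) + (C - 1ℚ) * (0ℚ - 0ℚ) + (0ℚ - 1ℚ) * 0ℚ            ≡⟨ solve (C ∷ []) ℚ-ring ⟩
      0ℚ - 0ℚ                                                     ∎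
    LY-offDiagonal vA vP _ = begin
      B * (0ℚ - u) + C * (0ℚ - 0ℚ) + (0ℚ - 0ℚ) * u                 ≡⟨ solve (B ∷ C ∷ u ∷ []) ℚ-ring ⟩
      0ℚ - B * u                                                  ≡⟨ cong (λ x → 0ℚ - x) hu ⟩
      0ℚ - 1ℚ                                                     ∎
    LY-offDiagonal vP vP _ = begin
      B * (u - u) + (0ℚ - 0ℚ) * u                                 ≡⟨ solve (B ∷ u ∷ []) ℚ-ring ⟩
      0ℚ - 0ℚ                                                     ∎
    LY-offDiagonal vQ vP _ = begin
      (u - 0ℚ) + A * (u - u) + (0ℚ - 1ℚ) * u                      ≡⟨ solve (A ∷ u ∷ []) ℚ-ring ⟩
      0ℚ - 0ℚ                                                     ∎
    LY-offDiagonal vN vP _ = begin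
      (0ℚ - 0ℚ) + (C - 1ℚ) * (0ℚ - 0ℚ) + (0ℚ - 0ℚ) * u             ≡⟨ solve (C ∷ u ∷ []) ℚ-ring ⟩
      0ℚ - 0ℚ                                                     ∎
    LY-offDiagonal vA vQ _ = begin
      B * (0ℚ - (u - u * v)) + C * (0ℚ - 0ℚ) + (0ℚ - 1ℚ) * v       ≡⟨ solve (B ∷ C ∷ u ∷ v ∷ []) ℚ-ring ⟩
      (B * u) * v - B * u - v                                     ≡⟨ cong (λ x → x * v - x - v) hu ⟩
      1ℚ * v - 1ℚ - v                                             ≡⟨ solve (v ∷ []) ℚ-ring ⟩
      0ℚ - 1ℚ                                                     ∎
    LY-offDiagonal vP vQ _ = begin
      B * (u - (u - u * v)) + (0ℚ - 1ℚ) * v                       ≡⟨ solve (B ∷ u ∷ v ∷ []) ℚ-ring ⟩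
      (B * u) * v - v                                             ≡⟨ cong (λ x → x * v - v) hu ⟩
      1ℚ * v - v                                                  ≡⟨ solve (v ∷ []) ℚ-ring ⟩
      0ℚ - 0ℚ                                                     ∎
    LY-offDiagonal vQ vQ _ = begin
      (u - u * v - 0ℚ) + A * (u - u * v - u) + (0ℚ - 0ℚ) * v       ≡⟨ solve (A ∷ u ∷ v ∷ []) ℚ-ring ⟩
      u - ((1ℚ + A) * v) * u                                      ≡⟨ cong (λ x → u - x * u) hv ⟩
      u - 1ℚ * u                                                  ≡⟨ solve (u ∷ []) ℚ-ring ⟩
      0ℚ - 0ℚ                                                     ∎
    LY-offDiagonal vN vQ _ = begin
      (0ℚ - 0ℚ) + (C - 1ℚ) * (0ℚ - 0ℚ) + (0ℚ - 0ℚ) * v             ≡⟨ solve (C ∷ v ∷ []) ℚ-ring ⟩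
      0ℚ - 0ℚ                                                     ∎
    LY-offDiagonal vA vN _ = begin
      B * (0ℚ - 0ℚ) + C * (0ℚ - w) + (0ℚ - 1ℚ) * w                 ≡⟨ solve (B ∷ C ∷ w ∷ []) ℚ-ring ⟩
      0ℚ - (1ℚ + C) * w                                           ≡⟨ cong (λ x → 0ℚ - x) hw ⟩
      0ℚ - 1ℚ                                                     ∎
    LY-offDiagonal vP vN _ = begin
      B * (0ℚ - 0ℚ) + (0ℚ - 0ℚ) * w                               ≡⟨ solve (B ∷ w ∷ []) ℚ-ring ⟩
      0ℚ - 0ℚ                                                     ∎
    LY-offDiagonal vQ vN _ = begin
      (0ℚ - 0ℚ) + A * (0ℚ - 0ℚ) + (0ℚ - 0ℚ) * w                    ≡⟨ solve (A ∷ w ∷ []) ℚ-ring ⟩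
      0ℚ - 0ℚ                                                     ∎
    LY-offDiagonal vN vN _ = begin
      (w - 0ℚ) + (C - 1ℚ) * (w - w) + (0ℚ - 1ℚ) * w                ≡⟨ solve (C ∷ w ∷ []) ℚ-ring ⟩
      0ℚ - 0ℚ                                                     ∎

    ρ : Kind → Kind → ℚ
    ρ K K′ = (y₀ K K + y₁ K) + (y₀ K′ K′ + y₁ K′) - 2ℚ * y₀ K K′

    ρ-AP : ρ vA vP ≡ 2ℚ * u
    ρ-AP = begin (0ℚ + 0ℚ) + (u + u) - 2ℚ * 0ℚ ≡⟨ solve (u ∷ []) ℚ-ring ⟩ 2ℚ * u ∎

    ρ-AQ : ρ vA vQ ≡ u + v - u * v
    ρ-AQ = begin (0ℚ + 0ℚ) + ((u - u * v) + v) - 2ℚ * 0ℚ ≡⟨ solve (u ∷ v ∷ []) ℚ-ring ⟩ u + v - u * v ∎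

    ρ-AN : ρ vA vN ≡ 2ℚ * w
    ρ-AN = begin (0ℚ + 0ℚ) + (w + w) - 2ℚ * 0ℚ ≡⟨ solve (w ∷ []) ℚ-ring ⟩ 2ℚ * w ∎

    ρ-PP : ρ vP vP ≡ 2ℚ * u
    ρ-PP = begin (u + u) + (u + u) - 2ℚ * u ≡⟨ solve (u ∷ []) ℚ-ring ⟩ 2ℚ * u ∎

    ρ-PQ : ρ vP vQ ≡ u + v - u * v
    ρ-PQ = begin (u + u) + ((u - u * v) + v) - 2ℚ * u ≡⟨ solve (u ∷ v ∷ []) ℚ-ring ⟩ u + v - u * v ∎

    ρ-PN : ρ vP vN ≡ 2ℚ * (u + w)
    ρ-PN = begin (u + u) + (w + w) - 2ℚ * 0ℚ ≡⟨ solve (u ∷ w ∷ []) ℚ-ring ⟩ 2ℚ * (u + w) ∎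

    ρ-QQ : ρ vQ vQ ≡ 2ℚ * v
    ρ-QQ = begin ((u - u * v) + v) + ((u - u * v) + v) - 2ℚ * (u - u * v) ≡⟨ solve (u ∷ v ∷ []) ℚ-ring ⟩ 2ℚ * v ∎

    ρ-QN : ρ vQ vN ≡ u + v - u * v + 2ℚ * w
    ρ-QN = begin ((u - u * v) + v) + (w + w) - 2ℚ * 0ℚ ≡⟨ solve (u ∷ v ∷ w ∷ []) ℚ-ring ⟩ u + v - u * v + 2ℚ * w ∎

    ρ-NN : ρ vN vN ≡ 2ℚ * w
    ρ-NN = begin (w + w) + (w + w) - 2ℚ * w ≡⟨ solve (w ∷ []) ℚ-ring ⟩ 2ℚ * w ∎

    2u-cleared : B * (2ℚ * u) ≡ 2ℚ
    2u-cleared = begin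
      B * (2ℚ * u)   ≡⟨ solve (B ∷ u ∷ []) ℚ-ring ⟩
      2ℚ * (B * u)   ≡⟨ cong (2ℚ *_) hu ⟩
      2ℚ * 1ℚ        ∎

    2v-cleared : (1ℚ + A) * (2ℚ * v) ≡ 2ℚ
    2v-cleared = begin
      (1ℚ + A) * (2ℚ * v)   ≡⟨ solve (A ∷ v ∷ []) ℚ-ring ⟩
      2ℚ * ((1ℚ + A) * v)   ≡⟨ cong (2ℚ *_) hv ⟩
      2ℚ * 1ℚ               ∎

    2w-cleared : (1ℚ + C) * (2ℚ * w) ≡ 2ℚ
    2w-cleared = begin
      (1ℚ + C) * (2ℚ * w)   ≡⟨ solve (C ∷ w ∷ []) ℚ-ring ⟩
      2ℚ * ((1ℚ + C) * w)   ≡⟨ cong (2ℚ *_) hw ⟩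
      2ℚ * 1ℚ               ∎

    ρ-AQ-cleared : ((1ℚ + A) * B) * (u + v - u * v) ≡ A + B
    ρ-AQ-cleared = begin
      ((1ℚ + A) * B) * (u + v - u * v)                                  ≡⟨ solve (A ∷ B ∷ u ∷ v ∷ []) ℚ-ring ⟩
      (1ℚ + A) * (B * u) + B * ((1ℚ + A) * v) - (B * u) * ((1ℚ + A) * v)  ≡⟨ cong₂ (λ x y → (1ℚ + A) * x + B * y - x * y) hu hv ⟩
      (1ℚ + A) * 1ℚ + B * 1ℚ - 1ℚ * 1ℚ                                    ≡⟨ solve (A ∷ B ∷ []) ℚ-ring ⟩
      A + B                                                             ∎

    ρ-PN-cleared : (B * (1ℚ + C)) * (2ℚ * (u + w)) ≡ 2ℚ * (B + (1ℚ + C))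
    ρ-PN-cleared = begin
      (B * (1ℚ + C)) * (2ℚ * (u + w))                      ≡⟨ solve (B ∷ C ∷ u ∷ w ∷ []) ℚ-ring ⟩
      2ℚ * ((1ℚ + C) * (B * u) + B * ((1ℚ + C) * w))       ≡⟨ cong₂ (λ x y → 2ℚ * ((1ℚ + C) * x + B * y)) hu hw ⟩
      2ℚ * ((1ℚ + C) * 1ℚ + B * 1ℚ)                        ≡⟨ solve (B ∷ C ∷ []) ℚ-ring ⟩
      2ℚ * (B + (1ℚ + C))                                  ∎

    ρ-QN-cleared : (((1ℚ + C) * (1ℚ + A)) * B) * (u + v - u * v + 2ℚ * w) ≡ B * ((1ℚ + C) + 2ℚ * (1ℚ + A)) + (1ℚ + C) * A
    ρ-QN-cleared = begin
      (((1ℚ + C) * (1ℚ + A)) * B) * (u + v - u * v + 2ℚ * w)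
        ≡⟨ solve (A ∷ B ∷ C ∷ u ∷ v ∷ w ∷ []) ℚ-ring ⟩
      (1ℚ + C) * (1ℚ + A) * (B * u) + (1ℚ + C) * B * ((1ℚ + A) * v)
        - (1ℚ + C) * (B * u) * ((1ℚ + A) * v) + 2ℚ * (1ℚ + A) * B * ((1ℚ + C) * w)
        ≡⟨ substitute hu hv hw ⟩
      (1ℚ + C) * (1ℚ + A) * 1ℚ + (1ℚ + C) * B * 1ℚ - (1ℚ + C) * 1ℚ * 1ℚ + 2ℚ * (1ℚ + A) * B * 1ℚ
        ≡⟨ solve (A ∷ B ∷ C ∷ []) ℚ-ring ⟩
      B * ((1ℚ + C) + 2ℚ * (1ℚ + A)) + (1ℚ + C) * A
        ∎
      where
      substitute : ∀ {x x′ y y′ z z′} → x ≡ x′ → y ≡ y′ → z ≡ z′ →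
        (1ℚ + C) * (1ℚ + A) * x + (1ℚ + C) * B * y - (1ℚ + C) * x * y + 2ℚ * (1ℚ + A) * B * z
          ≡ (1ℚ + C) * (1ℚ + A) * x′ + (1ℚ + C) * B * y′ - (1ℚ + C) * x′ * y′ + 2ℚ * (1ℚ + A) * B * z′
      substitute refl refl refl = refl

  module Graph (p₀ q₀ n₀ : ℕ) where
    p q n m : ℕ
    p = suc p₀
    q = suc q₀
    n = suc (suc n₀)
    m = nV p q n

    u v w : ℚ
    u = + 1 / q
    v = + 1 / p
    w = + 1 / n

    open Blocks (fromℕ p₀) (fromℕ q) (fromℕ (suc n₀)) u v w
      (fromℕ-*-inverse q₀) (fromℕ-*-inverse p₀) (fromℕ-*-inverse (suc n₀)) public

    κ : Fin m → Kind
    κ i = kind p q (toℕ i)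

    L Y : Mat m
    L = laplacian p q n
    Y i j = y₀ (κ i) (κ j) + δ i j * y₁ (κ j)

    open ≡-Reasoning

    sumBelow-kinds : ∀ H → sumBelow m (λ k → H (kind p q k)) ≡ count H
    sumBelow-kinds H = begin
      H vA + sumBelow (p₀ ℕ.+ q ℕ.+ suc n₀) g
        ≡⟨ cong (λ s → H vA + s) (sumBelow-+ (p₀ ℕ.+ q) (suc n₀) g) ⟩
      H vA + (sumBelow (p₀ ℕ.+ q) g + sumBelow (suc n₀) (λ k → g (p₀ ℕ.+ q ℕ.+ k)))
        ≡⟨ cong (λ s → H vA + (s + sumBelow (suc n₀) (λ k → g (p₀ ℕ.+ q ℕ.+ k)))) (sumBelow-+ p₀ q g) ⟩
      H vA + (sumBelow p₀ g + sumBelow q (λ k → g (p₀ ℕ.+ k)) + sumBelow (suc n₀) (λ k → g (p₀ ℕ.+ q ℕ.+ k)))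
        ≡⟨ cong (λ s → H vA + s) (cong₂ _+_ (cong₂ _+_
             (sumBelow-const p₀ g (λ k k<p₀ → cong H (kind-vP p₀ q k k<p₀)))
             (sumBelow-const q (λ k → g (p₀ ℕ.+ k)) (λ k k<q → cong H (kind-vQ p₀ q k k<q))))
             (sumBelow-const (suc n₀) (λ k → g (p₀ ℕ.+ q ℕ.+ k)) (λ k _ → cong H (kind-vN p₀ q k)))) ⟩
      H vA + (fromℕ p₀ * H vP + fromℕ q * H vQ + fromℕ (suc n₀) * H vN)
        ≡⟨ assoc (H vA) _ _ _ ⟩
      count H
        ∎
      where
      g : ℕ → ℚ
      g k = H (kind p q (suc k))
      assoc : ∀ a b c d → a + (b + c + d) ≡ a + b + c + d
      assoc = solve-∀ ℚ-ring

    sumFin-kinds : ∀ H → sumFin (λ k → H (κ k)) ≡ count H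
    sumFin-kinds H = trans (sumFin-toℕ {m} (λ k → H (kind p q k))) (sumBelow-kinds H)

    adjacency-neighbourSum : ∀ i h → sumFin (λ k → adjacency p q n i k * h (κ k)) ≡ neighbourSum (κ i) h
    adjacency-neighbourSum i h = begin
      sumFin (λ k → adjacency p q n i k * h (κ k))   ≡⟨ sumFin-cong pointwise ⟩
      sumFin (λ k → f k - δ i k * f k)               ≡⟨ sumFin-- f (λ k → δ i k * f k) ⟩
      sumFin f - sumFin (λ k → δ i k * f k)          ≡⟨ cong₂ _-_ (sumFin-kinds (λ K → b2q (kindAdj (κ i) K) * h K)) (sumFin-δˡ i f) ⟩
      count (λ K → b2q (kindAdj (κ i) K) * h K) - f i ≡⟨ count-kindAdj (κ i) h ⟩
      neighbourSum (κ i) h                           ∎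
      where
      f : Fin m → ℚ
      f k = b2q (kindAdj (κ i) (κ k)) * h (κ k)
      expand : ∀ x e y → (x - e * x) * y ≡ x * y - e * (x * y)
      expand = solve-∀ ℚ-ring
      pointwise : ∀ k → adjacency p q n i k * h (κ k) ≡ f k - δ i k * f k
      pointwise k = begin
        b2q (adj p q (toℕ i) (toℕ k)) * h (κ k)
          ≡⟨ cong (λ b → b2q b * h (κ k)) (adj-kinds p q (toℕ i) (toℕ k)) ⟩
        b2q (kindAdj (κ i) (κ k) ∧ not (toℕ i ≡ᵇ toℕ k)) * h (κ k)
          ≡⟨ cong (_* h (κ k)) (b2q-∧-not (kindAdj (κ i) (κ k)) (toℕ i ≡ᵇ toℕ k)) ⟩
        (b2q (kindAdj (κ i) (κ k)) - δ i k * b2q (kindAdj (κ i) (κ k))) * h (κ k)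
          ≡⟨ expand (b2q (kindAdj (κ i) (κ k))) (δ i k) (h (κ k)) ⟩
        f k - δ i k * f k
          ∎

    L-action : ∀ i (g : Kind → ℚ) → sumFin (λ k → L i k * g (κ k)) ≡ neighbourSum (κ i) (λ K → g (κ i) - g K)
    L-action i g = trans (laplacian-action (adjacency p q n) (λ k → g (κ k)) i)
                         (adjacency-neighbourSum i (λ K → g (κ i) - g K))

    L-diagonal : ∀ i → L i i ≡ deg (κ i)
    L-diagonal i = begin
      (if toℕ i ≡ᵇ toℕ i then degree p q n i else 0ℚ) - b2q (adj p q (toℕ i) (toℕ i))
        ≡⟨ cong₂ (λ b e → (if b then degree p q n i else 0ℚ) - b2q e) (≡ᵇ-refl (toℕ i)) (adj-irrefl p q (toℕ i)) ⟩
      degree p q n i - 0ℚ                        ≡⟨ ℚ.+-identityʳ _ ⟩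
      degree p q n i                             ≡⟨ sumFin-cong (λ k → ℚ.*-identityʳ (adjacency p q n i k)) ⟨
      sumFin (λ k → adjacency p q n i k * 1ℚ)    ≡⟨ adjacency-neighbourSum i (λ _ → 1ℚ) ⟩
      deg (κ i)                                  ∎

    L-offDiagonal : ∀ i j → toℕ i ≢ toℕ j → L i j ≡ 0ℚ - b2q (kindAdj (κ i) (κ j))
    L-offDiagonal i j i≢j =
      cong₂ (λ b e → (if b then degree p q n i else 0ℚ) - b2q e) (≡ᵇ-false i≢j) (adj-offDiagonal p q i≢j)

    L-sym : ∀ i j → L i j ≡ L j i
    L-sym i j = by-cases (toℕ i ℕ.≟ toℕ j)
      where
      by-cases : Dec (toℕ i ≡ toℕ j) → L i j ≡ L j i
      by-cases (yes i≡j) = cong₂ L (toℕ-injective i≡j) (sym (toℕ-injective i≡j))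
      by-cases (no  i≢j) = begin
        L i j                             ≡⟨ L-offDiagonal i j i≢j ⟩
        0ℚ - b2q (kindAdj (κ i) (κ j))    ≡⟨ cong (λ b → 0ℚ - b2q b) (kindAdj-sym (κ i) (κ j)) ⟩
        0ℚ - b2q (kindAdj (κ j) (κ i))    ≡⟨ L-offDiagonal j i (λ j≡i → i≢j (sym j≡i)) ⟨
        L j i                             ∎

    L-rowSum : ∀ i → sumFin (L i) ≡ 0ℚ
    L-rowSum i = begin
      sumFin (L i)                                     ≡⟨ sumFin-cong (λ k → ℚ.*-identityʳ (L i k)) ⟨
      sumFin (λ k → L i k * 1ℚ)                        ≡⟨ laplacian-action (adjacency p q n) (λ _ → 1ℚ) i ⟩
      sumFin (λ k → adjacency p q n i k * (1ℚ - 1ℚ))   ≡⟨ sumFin-zero (λ k → ℚ.*-zeroʳ (adjacency p q n i k)) ⟩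
      0ℚ                                               ∎

    Y-diagonal : ∀ i → Y i i ≡ y₀ (κ i) (κ i) + y₁ (κ i)
    Y-diagonal i = begin
      y₀ (κ i) (κ i) + b2q (toℕ i ≡ᵇ toℕ i) * y₁ (κ i)   ≡⟨ cong (λ b → y₀ (κ i) (κ i) + b2q b * y₁ (κ i)) (≡ᵇ-refl (toℕ i)) ⟩
      y₀ (κ i) (κ i) + 1ℚ * y₁ (κ i)                     ≡⟨ cong (λ x → y₀ (κ i) (κ i) + x) (ℚ.*-identityˡ (y₁ (κ i))) ⟩
      y₀ (κ i) (κ i) + y₁ (κ i)                          ∎

    Y-offDiagonal : ∀ {i j} → toℕ i ≢ toℕ j → Y i j ≡ y₀ (κ i) (κ j)
    Y-offDiagonal {i} {j} i≢j = begin
      y₀ (κ i) (κ j) + b2q (toℕ i ≡ᵇ toℕ j) * y₁ (κ j)   ≡⟨ cong (λ b → y₀ (κ i) (κ j) + b2q b * y₁ (κ j)) (≡ᵇ-false i≢j) ⟩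
      y₀ (κ i) (κ j) + 0ℚ * y₁ (κ j)                     ≡⟨ cong (λ x → y₀ (κ i) (κ j) + x) (ℚ.*-zeroˡ (y₁ (κ j))) ⟩
      y₀ (κ i) (κ j) + 0ℚ                                ≡⟨ ℚ.+-identityʳ (y₀ (κ i) (κ j)) ⟩
      y₀ (κ i) (κ j)                                     ∎

    Y-sym : ∀ i j → Y i j ≡ Y j i
    Y-sym i j = by-cases (toℕ i ℕ.≟ toℕ j)
      where
      by-cases : Dec (toℕ i ≡ toℕ j) → Y i j ≡ Y j i
      by-cases (yes i≡j) = cong₂ Y (toℕ-injective i≡j) (sym (toℕ-injective i≡j))
      by-cases (no  i≢j) = begin
        Y i j            ≡⟨ Y-offDiagonal i≢j ⟩
        y₀ (κ i) (κ j)   ≡⟨ y₀-sym (κ i) (κ j) ⟩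
        y₀ (κ j) (κ i)   ≡⟨ Y-offDiagonal (λ j≡i → i≢j (sym j≡i)) ⟨
        Y j i            ∎

    LY-entry : ∀ i j → (L ⊗ Y) i j ≡ neighbourSum (κ i) (λ K → y₀ (κ i) (κ j) - y₀ K (κ j)) + L i j * y₁ (κ j)
    LY-entry i j = begin
      sumFin (λ k → L i k * (y₀ (κ k) (κ j) + δ k j * y₁ (κ j)))
        ≡⟨ sumFin-cong (λ k → distrib (L i k) (y₀ (κ k) (κ j)) (δ k j) (y₁ (κ j))) ⟩
      sumFin (λ k → L i k * y₀ (κ k) (κ j) + L i k * δ k j * y₁ (κ j))
        ≡⟨ sumFin-+ (λ k → L i k * y₀ (κ k) (κ j)) (λ k → L i k * δ k j * y₁ (κ j)) ⟩
      sumFin (λ k → L i k * y₀ (κ k) (κ j)) + sumFin (λ k → L i k * δ k j * y₁ (κ j))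
        ≡⟨ cong₂ _+_ (L-action i (λ K → y₀ K (κ j)))
                     (trans (sumFin-*ʳ (y₁ (κ j)) (λ k → L i k * δ k j)) (cong (_* y₁ (κ j)) (sumFin-δʳ j (L i)))) ⟩
      neighbourSum (κ i) (λ K → y₀ (κ i) (κ j) - y₀ K (κ j)) + L i j * y₁ (κ j)
        ∎
      where
      distrib : ∀ l y d z → l * (y + d * z) ≡ l * y + l * d * z
      distrib = solve-∀ ℚ-ring

    column : Kind → Kind → ℚ
    column K K′ = neighbourSum K (λ K″ → y₀ K K′ - y₀ K″ K′)

    LY-diagonal-entry : ∀ i → (L ⊗ Y) i i ≡ grounded zero i i
    LY-diagonal-entry i = begin
      (L ⊗ Y) i i                                  ≡⟨ LY-entry i i ⟩
      column (κ i) (κ i) + L i i * y₁ (κ i)        ≡⟨ cong (λ x → column (κ i) (κ i) + x * y₁ (κ i)) (L-diagonal i) ⟩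
      column (κ i) (κ i) + deg (κ i) * y₁ (κ i)    ≡⟨ LY-diagonal (κ i) ⟩
      1ℚ - atA (κ i)                               ≡⟨ cong₂ _-_ (cong b2q (≡ᵇ-refl (toℕ i))) (atA-kind p q (toℕ i)) ⟨
      grounded zero i i                            ∎

    LY-offDiagonal-entry : ∀ i j → toℕ i ≢ toℕ j → (L ⊗ Y) i j ≡ grounded zero i j
    LY-offDiagonal-entry i j i≢j = begin
      (L ⊗ Y) i j                                                      ≡⟨ LY-entry i j ⟩
      column (κ i) (κ j) + L i j * y₁ (κ j)
        ≡⟨ cong (λ x → column (κ i) (κ j) + x * y₁ (κ j)) (L-offDiagonal i j i≢j) ⟩
      column (κ i) (κ j) + (0ℚ - b2q (kindAdj (κ i) (κ j))) * y₁ (κ j) ≡⟨ LY-offDiagonal (κ i) (κ j) not-both-a ⟩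
      0ℚ - atA (κ i)                                                   ≡⟨ cong₂ _-_ (cong b2q (≡ᵇ-false i≢j)) (atA-kind p q (toℕ i)) ⟨
      grounded zero i j                                                ∎
      where
      not-both-a : κ i ≡ vA → κ j ≡ vA → ⊥
      not-both-a i-is-a j-is-a = i≢j (trans (kind-vA p q (toℕ i) i-is-a) (sym (kind-vA p q (toℕ j) j-is-a)))

    LY≈grounded : L ⊗ Y ≈ᴹ grounded zero
    LY≈grounded i j = by-cases (toℕ i ℕ.≟ toℕ j)
      where
      by-cases : Dec (toℕ i ≡ toℕ j) → (L ⊗ Y) i j ≡ grounded zero i j
      by-cases (yes i≡j) = subst (λ j → (L ⊗ Y) i j ≡ grounded zero i j) (toℕ-injective i≡j) (LY-diagonal-entry i)
      by-cases (no  i≢j) = LY-offDiagonal-entry i j i≢j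

    m*[1/m]≡1 : fromℕ m * (+ 1 / m) ≡ 1ℚ
    m*[1/m]≡1 = fromℕ-*-inverse (p₀ ℕ.+ q ℕ.+ suc n₀)

    open GroundedInverse L Y zero (+ 1 / m) m*[1/m]≡1 L-sym L-rowSum Y-sym LY≈grounded public
      using (X; X-isGroupInverse; resistance-groupInverse)

    resistance-Y : ∀ {i j} → toℕ i ≢ toℕ j → resistance Y i j ≡ ρ (κ i) (κ j)
    resistance-Y {i} {j} i≢j = cong₂ _-_ (cong₂ _+_ (Y-diagonal i) (Y-diagonal j)) (cong (2ℚ *_) (Y-offDiagonal i≢j))

    resistance-between : ∀ {X′} → IsGroupInverse L X′ → ∀ {K K′} i j → κ i ≡ K → κ j ≡ K′ → toℕ i ≢ toℕ j →
      resistance X′ i j ≡ ρ K K′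
    resistance-between X′-isGroupInverse i j refl refl i≢j =
      trans (resistance-groupInverse X′-isGroupInverse i j) (resistance-Y i≢j)

    kinds-differ : ∀ {i j K K′} → κ i ≡ K → κ j ≡ K′ → K ≢ K′ → toℕ i ≢ toℕ j
    kinds-differ refl refl K≢K′ i≡j = K≢K′ (cong (kind p q) i≡j)

    2/q : frac (+ 2) q ≡ 2ℚ * u
    2/q = frac-unique 2 q refl refl 2u-cleared

    2/p : frac (+ 2) p ≡ 2ℚ * v
    2/p = frac-unique 2 p refl refl 2v-cleared

    2/n : frac (+ 2) n ≡ 2ℚ * w
    2/n = frac-unique 2 n refl refl 2w-cleared

    [p+q-1]/pq : frac (+ (p ℕ.+ q ℕ.∸ 1)) (p ℕ.* q) ≡ u + v - u * v
    [p+q-1]/pq = frac-unique (p₀ ℕ.+ q) (p ℕ.* q) (fromℕ-* p q) (fromℕ-+ p₀ q) ρ-AQ-cleared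

    2[q+n]/qn : frac (+ (2 ℕ.* (q ℕ.+ n))) (q ℕ.* n) ≡ 2ℚ * (u + w)
    2[q+n]/qn = frac-unique (2 ℕ.* (q ℕ.+ n)) (q ℕ.* n)
      (fromℕ-* q n) (trans (fromℕ-* 2 (q ℕ.+ n)) (cong (2ℚ *_) (fromℕ-+ q n))) ρ-PN-cleared

    [q[n+2p]+n[p-1]]/npq : frac (+ (q ℕ.* (n ℕ.+ 2 ℕ.* p) ℕ.+ n ℕ.* (p ℕ.∸ 1))) (n ℕ.* p ℕ.* q) ≡ u + v - u * v + 2ℚ * w
    [q[n+2p]+n[p-1]]/npq = frac-unique (q ℕ.* (n ℕ.+ 2 ℕ.* p) ℕ.+ n ℕ.* p₀) (n ℕ.* p ℕ.* q)
      (trans (fromℕ-* (n ℕ.* p) q) (cong (_* fromℕ q) (fromℕ-* n p)))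
      (trans (fromℕ-+ (q ℕ.* (n ℕ.+ 2 ℕ.* p)) (n ℕ.* p₀)) (cong₂ _+_
        (trans (fromℕ-* q (n ℕ.+ 2 ℕ.* p)) (cong (λ x → fromℕ q * x) (trans (fromℕ-+ n (2 ℕ.* p)) (cong (λ x → fromℕ n + x) (fromℕ-* 2 p)))))
        (fromℕ-* n p₀)))
      ρ-QN-cleared

open Development
open import Data.Nat using (ℕ; _≤_; _+_; _*_; _∸_; zero; suc; s≤s)
open import Data.Fin using (Fin; toℕ)
open import Data.Fin.Properties using (toℕ-injective)
open import Data.Product using (_×_; ∃; _,_)
open import Data.Integer using (+_)
open import Relation.Binary.PropositionalEquality using (_≡_; _≢_; trans; sym)

theorem3p5 : (p q n : ℕ) → 1 ≤ p → 1 ≤ q → 2 ≤ n →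
    (∃ λ (X : Mat (nV p q n)) → IsGroupInverse (laplacian p q n) X) ×
    ((X : Mat (nV p q n)) → IsGroupInverse (laplacian p q n) X →
      ((a x : Fin (nV p q n)) → kind p q (toℕ a) ≡ vA → kind p q (toℕ x) ≡ vP →
          resistance X a x ≡ frac (+ 2) q) ×
      ((a y : Fin (nV p q n)) → kind p q (toℕ a) ≡ vA → kind p q (toℕ y) ≡ vQ →
          resistance X a y ≡ frac (+ (p + q ∸ 1)) (p * q)) ×
      ((a z : Fin (nV p q n)) → kind p q (toℕ a) ≡ vA → kind p q (toℕ z) ≡ vN →
          resistance X a z ≡ frac (+ 2) n) ×
      ((x x′ : Fin (nV p q n)) → kind p q (toℕ x) ≡ vP → kind p q (toℕ x′) ≡ vP → x ≢ x′ →
          resistance X x x′ ≡ frac (+ 2) q) ×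
      ((x y : Fin (nV p q n)) → kind p q (toℕ x) ≡ vP → kind p q (toℕ y) ≡ vQ →
          resistance X x y ≡ frac (+ (p + q ∸ 1)) (p * q)) ×
      ((x z : Fin (nV p q n)) → kind p q (toℕ x) ≡ vP → kind p q (toℕ z) ≡ vN →
          resistance X x z ≡ frac (+ (2 * (q + n))) (q * n)) ×
      ((y y′ : Fin (nV p q n)) → kind p q (toℕ y) ≡ vQ → kind p q (toℕ y′) ≡ vQ → y ≢ y′ →
          resistance X y y′ ≡ frac (+ 2) p) ×
      ((y z : Fin (nV p q n)) → kind p q (toℕ y) ≡ vQ → kind p q (toℕ z) ≡ vN →
          resistance X y z ≡ frac (+ (q * (n + 2 * p) + n * (p ∸ 1))) (n * p * q)) ×
      ((z z′ : Fin (nV p q n)) → kind p q (toℕ z) ≡ vN → kind p q (toℕ z′) ≡ vN → z ≢ z′ →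
          resistance X z z′ ≡ frac (+ 2) n))
theorem3p5 zero    _       _             ()  _   _
theorem3p5 (suc _) zero    _             _   ()  _
theorem3p5 (suc _) (suc _) zero          _   _   ()
theorem3p5 (suc _) (suc _) (suc zero)    _   _   (s≤s ())
theorem3p5 (suc p₀) (suc q₀) (suc (suc n₀)) _ _ _ = (X , X-isGroupInverse) , λ X′ X′-isGroupInverse →
  let r = resistance-between X′-isGroupInverse
      distinct = λ {i} {j} (i≢j : i ≢ j) e → i≢j (toℕ-injective e)
  in (λ a x ka kx → trans (r a x ka kx (kinds-differ ka kx λ ())) (trans ρ-AP (sym 2/q)))
   , (λ a y ka ky → trans (r a y ka ky (kinds-differ ka ky λ ())) (trans ρ-AQ (sym [p+q-1]/pq)))
   , (λ a z ka kz → trans (r a z ka kz (kinds-differ ka kz λ ())) (trans ρ-AN (sym 2/n)))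
   , (λ x x′ kx kx′ x≢x′ → trans (r x x′ kx kx′ (distinct x≢x′)) (trans ρ-PP (sym 2/q)))
   , (λ x y kx ky → trans (r x y kx ky (kinds-differ kx ky λ ())) (trans ρ-PQ (sym [p+q-1]/pq)))
   , (λ x z kx kz → trans (r x z kx kz (kinds-differ kx kz λ ())) (trans ρ-PN (sym 2[q+n]/qn)))
   , (λ y y′ ky ky′ y≢y′ → trans (r y y′ ky ky′ (distinct y≢y′)) (trans ρ-QQ (sym 2/p)))
   , (λ y z ky kz → trans (r y z ky kz (kinds-differ ky kz λ ())) (trans ρ-QN (sym [q[n+2p]+n[p-1]]/npq)))
   , (λ z z′ kz kz′ z≢z′ → trans (r z z′ kz kz′ (distinct z≢z′)) (trans ρ-NN (sym 2/n)))
  where open Graph p₀ q₀ n₀
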